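{- Suppose $P$ is a $2$-chain of size $n$, and write $P=\mathcal{Q}(n_1)\mathbin{\square}\cdots\mathbin{\square}\mathcal{Q}(n_s)$ for $n_1,\dots,n_s\geq 3$ with $n_1+\dots+n_s=n+2s-2$. Then the number of covers in $P$ is $2n-s-4$.
   Context: All posets are finite; partial orders are written $\preceq$. A poset $(P,\preceq)$ is a $2$-chain if (1) there is a unique way to write $P$ as the union of two chains, and (2) $\preceq$ is maximal subject to (1), i.e. for every proper refinement $\preceq^+$ of $\preceq$ there is more than one way to write $P$ as the union of two $\preceq^+$-chains. A cover is a pair $(a,b)$ with $a\prec b$ and no $c$ with $a\prec c\prec b$. $\mathcal{Q}(m)=\{1,\dots,m\}$ with $i\prec j$ iff $i\leq j-2$. Every $2$-chain with $n\ge3$ elements is isomorphic to such a splice for a unique choice of $n_1,\dots,n_s$. Splice: if $P$ has exactly two maximal elements $p_0,p_1$ with only $p_0$ supermaximal (above all non-maximal elements), and $Q$ has exactly two minimal elements $q_0,q_1$ with only $q_0$ superminimal, then $P\mathbin{\square}Q$ is obtained from $P\sqcup Q$ (orders within $P$, $Q$ unchanged; for $a\in P$, $b\in Q$: $a\preceq b$ iff $a\preceq p_i$ and $q_i\preceq b$ for some $i\in\{0,1\}$; no element of $Q$ below an element of $P$) by identifying $p_0$ with $q_0$ and $p_1$ with $q_1$. -}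

module Defs where

open import Data.Nat using (ℕ; zero; suc; _+_; _≤_; z≤n; s≤s)
open import Data.Fin using (Fin; zero; suc; toℕ; fromℕ; inject₁; _↑ˡ_; _↑ʳ_; _≟_; punchOut)
open import Data.Fin.Subset using (Subset; _∈_)
open import Data.List using (List; []; _∷_; length)
open import Data.List.Relation.Unary.All using (All; []; _∷_)
open import Data.List.Relation.Unary.Unique.Propositional using (Unique)
import Data.List.Membership.Propositional as LMem
open import Data.Product using (Σ; ∃; ∃₂; _×_; _,_; proj₁; proj₂)
open import Data.Sum using (_⊎_)
open import Relation.Binary.PropositionalEquality using (_≡_; _≢_)
open import Relation.Binary.Structures using (IsPartialOrder)
open import Relation.Nullary using (¬_; yes; no)
open import Function.Bundles using (_↔_; _⇔_; Inverse)

Rel : ℕ → Set₁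
Rel n = Fin n → Fin n → Set

Strict : ∀ {n} → Rel n → Rel n
Strict _≼_ a b = a ≼ b × a ≢ b

Cover : ∀ {n} → Rel n → Rel n
Cover R a b = Strict R a b × ¬ (∃ λ c → Strict R a c × Strict R c b)

NumCovers : ∀ {n} → Rel n → ℕ → Set
NumCovers {n} R k =
  Σ (List (Fin n × Fin n)) λ L →
    Unique L × (∀ a b → LMem._∈_ (a , b) L ⇔ Cover R a b) × length L ≡ k

IsChain : ∀ {n} → Rel n → Subset n → Set
IsChain R C = ∀ x y → x ∈ C → y ∈ C → R x y ⊎ R y x

TwoChainCover : ∀ {n} → Rel n → Subset n → Subset n → Set
TwoChainCover R C₁ C₂ = IsChain R C₁ × IsChain R C₂ × (∀ x → x ∈ C₁ ⊎ x ∈ C₂)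

SamePair : ∀ {n} → Subset n → Subset n → Subset n → Subset n → Set
SamePair C₁ C₂ D₁ D₂ = (D₁ ≡ C₁ × D₂ ≡ C₂) ⊎ (D₁ ≡ C₂ × D₂ ≡ C₁)

UniqueTwoChainCover : ∀ {n} → Rel n → Set
UniqueTwoChainCover R =
  ∃₂ λ C₁ C₂ → TwoChainCover R C₁ C₂ ×
    (∀ D₁ D₂ → TwoChainCover R D₁ D₂ → SamePair C₁ C₂ D₁ D₂)

SeveralTwoChainCovers : ∀ {n} → Rel n → Set
SeveralTwoChainCovers R =
  ∃₂ λ C₁ C₂ → ∃₂ λ D₁ D₂ →
    TwoChainCover R C₁ C₂ × TwoChainCover R D₁ D₂ × ¬ SamePair C₁ C₂ D₁ D₂

ProperRefinement : ∀ {n} → Rel n → Rel n → Set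
ProperRefinement R R⁺ =
  IsPartialOrder _≡_ R⁺ × (∀ x y → R x y → R⁺ x y) × (∃₂ λ x y → R⁺ x y × ¬ R x y)

IsTwoChain : ∀ {n} → Rel n → Set₁
IsTwoChain {n} R =
  UniqueTwoChainCover R ×
  ((R⁺ : Rel n) → ProperRefinement R R⁺ → SeveralTwoChainCovers R⁺)

Isomorphic : ∀ {n m} → Rel n → Rel m → Set
Isomorphic {n} {m} R S =
  Σ (Fin n ↔ Fin m) λ f → ∀ x y → R x y ⇔ S (Inverse.to f x) (Inverse.to f y)

-- Posets with two designated top points (p₀ supermaximal, p₁) and two
-- designated bottom points (q₀ superminimal, q₁), as used by the splice.

record BP (m : ℕ) : Set₁ where
  field
    _⊑_ : Rel m
    top₀ top₁ bot₀ bot₁ : Fin m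

-- 𝒬(m) = {1..m}, i ≺ j iff i ≤ j - 2 (elements i+1 are indexed by i : Fin m)
𝒬 : (m : ℕ) → Rel m
𝒬 m i j = i ≡ j ⊎ 2 + toℕ i ≤ toℕ j

-- 𝒬(k+2) with its maximal elements m (supermaximal), m-1 and its
-- minimal elements 1 (superminimal), 2
𝒬BP : (k : ℕ) → BP (suc (suc k))
𝒬BP k = record
  { _⊑_ = 𝒬 (suc (suc k))
  ; top₀ = fromℕ (suc k)
  ; top₁ = inject₁ (fromℕ k)
  ; bot₀ = zero
  ; bot₁ = suc zero
  }

-- The splice P □ Q.  The carrier Fin (p + q) consists of the elements of P
-- (first p indices) followed by the elements of Q other than q₀, q₁;
-- q₀ is identified with p₀ and q₁ with p₁.
module Splice {p q : ℕ} (P : BP p) (Q : BP (suc (suc q)))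
               (q₀≢q₁ : BP.bot₀ Q ≢ BP.bot₁ Q) where
  open BP P renaming (_⊑_ to _⊑P_; top₀ to p₀; top₁ to p₁)
  open BP Q renaming (_⊑_ to _⊑Q_; bot₀ to q₀; bot₁ to q₁)

  inP : Fin p → Fin (p + q)
  inP a = a ↑ˡ q

  inQ : Fin (suc (suc q)) → Fin (p + q)
  inQ b with q₀ ≟ b
  ... | yes _ = inP p₀
  ... | no q₀≢b with punchOut q₀≢q₁ ≟ punchOut q₀≢b
  ...   | yes _ = inP p₁
  ...   | no ne = p ↑ʳ punchOut ne

  _⊑S_ : Rel (p + q)
  x ⊑S y =
      (∃₂ λ a a' → inP a ≡ x × inP a' ≡ y × a ⊑P a')
    ⊎ (∃₂ λ b b' → inQ b ≡ x × inQ b' ≡ y × b ⊑Q b')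
    ⊎ (∃₂ λ a b → inP a ≡ x × inQ b ≡ y ×
                   ((a ⊑P p₀ × q₀ ⊑Q b) ⊎ (a ⊑P p₁ × q₁ ⊑Q b)))

  result : BP (p + q)
  result = record
    { _⊑_ = _⊑S_
    ; top₀ = inQ (BP.top₀ Q)
    ; top₁ = inQ (BP.top₁ Q)
    ; bot₀ = inP (BP.bot₀ P)
    ; bot₁ = inP (BP.bot₁ P)
    }

splice : ∀ {p q} (P : BP p) (Q : BP (suc (suc q))) →
         BP.bot₀ Q ≢ BP.bot₁ Q → BP (p + q)
splice P Q ne = Splice.result P Q ne

spliceRest : (N : ℕ) → BP N → (ms : List ℕ) → All (3 ≤_) ms → Σ ℕ BP
spliceRest N P [] [] = N , P
spliceRest N P (.(suc (suc (suc k))) ∷ ms) (s≤s (s≤s (s≤s {n = k} z≤n)) ∷ hs) =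
  spliceRest (N + suc k) (splice P (𝒬BP (suc k)) (λ ())) ms hs

splice𝒬 : (n₁ : ℕ) → 3 ≤ n₁ → (rest : List ℕ) → All (3 ≤_) rest → Σ ℕ BP
splice𝒬 .(suc (suc (suc k))) (s≤s (s≤s (s≤s {n = k} z≤n))) rest hs =
  spliceRest (suc (suc (suc k))) (𝒬BP (suc k)) rest hs

-- The covers of 𝒬(m) are exactly the pairs (i, i+2) and (i, i+3), so 𝒬(m) has
-- 2m − 5 covers.  In a splice P □ 𝒬(m) the poset P is down-closed and the copy
-- of 𝒬(m) is up-closed, so both keep exactly their covers; any other cover goes
-- from P into the new part of 𝒬(m), and it must start at one of the identified
-- points, since otherwise that point lies strictly between its ends.  Hence each
-- splice adds m − 2 elements and 2m − 5 covers, which preserves the identity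
-- c + s + 4 = 2N between the number c of covers, the number s of pieces and the
-- size N.  Covers are invariant under isomorphism, which transports the count.

module Submission where

open import Defs
open import Data.Nat using (ℕ; zero; suc; _+_; _*_; _∸_; _≤_; _<_; z≤n; s≤s; _≤?_)
open import Data.Nat.Properties
open import Data.Nat.ListAction using (sum)
open import Data.Nat.Tactic.RingSolver using (solve-∀)
open import Data.Fin using (Fin; zero; suc; toℕ; fromℕ; fromℕ<; inject₁; _↑ˡ_; _↑ʳ_; splitAt)
import Data.Fin as Fin
open import Data.Fin.Properties
  using (toℕ<n; toℕ-injective; toℕ-fromℕ; toℕ-fromℕ<; toℕ-inject₁; fromℕ≢inject₁;
         ↑ˡ-injective; ↑ʳ-injective; splitAt-↑ˡ; splitAt-↑ʳ; join-splitAt)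
  renaming (<⇒≢ to <⇒≢ᶠ; suc-injective to suc-injectiveᶠ)
open import Data.List using (List; []; _∷_; [_]; length; map; _++_)
open import Data.List.Properties using (length-map; length-++)
open import Data.List.Membership.Propositional using (_∈_)
open import Data.List.Membership.Propositional.Properties using (∈-map⁻; ∈-map⁺; ∈-++⁻; ∈-++⁺ˡ; ∈-++⁺ʳ)
open import Data.List.Relation.Unary.Any using (here)
open import Data.List.Relation.Unary.Any.Properties using (singleton⁻)
open import Data.List.Relation.Unary.All using (All; []; _∷_)
open import Data.List.Relation.Unary.AllPairs using ([]; _∷_)
open import Data.List.Relation.Unary.Unique.Propositional using (Unique)
import Data.List.Relation.Unary.Unique.Propositional.Properties as Unique
open import Data.Product using (Σ; ∃; _×_; _,_; proj₁; proj₂; uncurry)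
import Data.Product as Product
open import Data.Product.Properties using (,-injectiveˡ; ,-injectiveʳ)
open import Data.Sum using (_⊎_; inj₁; inj₂; [_,_]′)
import Data.Sum as Sum
open import Data.Empty using (⊥; ⊥-elim)
open import Function using (_∘_)
open import Function.Bundles using (_⇔_; mk⇔; Equivalence; Inverse; Injection)
open import Function.Construct.Composition using (_⇔-∘_)
open import Function.Construct.Symmetry using (↔-sym)
open import Function.Definitions using (Injective)
open import Function.Properties.Inverse using (↔⇒↣)
open import Relation.Nullary using (¬_; yes; no)
open import Relation.Binary.PropositionalEquality using (_≡_; _≢_; refl; sym; trans; cong; cong₂; subst; subst₂; module ≡-Reasoning)
open import Relation.Binary.Structures using (IsPartialOrder)

Count : {A : Set} → (A → Set) → ℕ → Set
Count {A} P k = Σ (List A) λ L → Unique L × (∀ x → x ∈ L ⇔ P x) × length L ≡ k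

Image : {A B : Set} → (A → B) → (A → Set) → B → Set
Image f P y = ∃ λ x → y ≡ f x × P x

module _ {A : Set} {P Q : A → Set} where

  Count-resp-⇔ : ∀ {k} → (∀ x → P x ⇔ Q x) → Count P k → Count Q k
  Count-resp-⇔ P⇔Q (L , unique , mem , len) = L , unique , (λ x → P⇔Q x ⇔-∘ mem x) , len

  Count-⊎ : ∀ {k l} → (∀ x → P x → Q x → ⊥) → Count P k → Count Q l →
            Count (λ x → P x ⊎ Q x) (k + l)
  Count-⊎ disjoint (L , uL , memL , lenL) (M , uM , memM , lenM) =
    L ++ M , Unique.++⁺ uL uM apart , (λ x → mk⇔ (split x) (join′ x)) ,
    trans (length-++ L) (cong₂ _+_ lenL lenM)
    where
    apart : ∀ {x} → ¬ (x ∈ L × x ∈ M)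
    apart {x} (x∈L , x∈M) = disjoint x (Equivalence.to (memL x) x∈L) (Equivalence.to (memM x) x∈M)
    split : ∀ x → x ∈ L ++ M → P x ⊎ Q x
    split x = Sum.map (Equivalence.to (memL x)) (Equivalence.to (memM x)) ∘ ∈-++⁻ L
    join′ : ∀ x → P x ⊎ Q x → x ∈ L ++ M
    join′ x = [ ∈-++⁺ˡ ∘ Equivalence.from (memL x) , ∈-++⁺ʳ L ∘ Equivalence.from (memM x) ]′

Count-singleton : {A : Set} (a : A) → Count (_≡ a) 1
Count-singleton a = [ a ] , [] ∷ [] , (λ x → mk⇔ singleton⁻ here) , refl

Count-image : {A B : Set} {P : A → Set} {f : A → B} {k : ℕ} →
              Injective _≡_ _≡_ f → Count P k → Count (Image f P) k
Count-image {f = f} f-injective (L , unique , mem , len) =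
  map f L , Unique.map⁺ f-injective unique , (λ y → mk⇔ (pull y) push) , trans (length-map f L) len
  where
  pull : ∀ y → y ∈ map f L → Image f _ y
  pull y y∈ with ∈-map⁻ f y∈
  ... | x , x∈L , y≡fx = x , y≡fx , Equivalence.to (mem x) x∈L
  push : ∀ {y} → Image f _ y → y ∈ map f L
  push (x , refl , Px) = ∈-map⁺ f (Equivalence.from (mem x) Px)

both : {A B : Set} → (A → B) → A × A → B × B
both f = Product.map f f

both-injective : {A B : Set} {f : A → B} → Injective _≡_ _≡_ f → Injective _≡_ _≡_ (both f)
both-injective f-injective e = cong₂ _,_ (f-injective (,-injectiveˡ e)) (f-injective (,-injectiveʳ e))

CoverCount : ∀ {n} → Rel n → ℕ → Set
CoverCount R = Count (uncurry (Cover R))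

CoverCount⇒NumCovers : ∀ {n k} {R : Rel n} → CoverCount R k → NumCovers R k
CoverCount⇒NumCovers (L , unique , mem , len) = L , unique , (λ a b → mem (a , b)) , len

ConvexImage : ∀ {n m} → Rel m → (Fin n → Fin m) → Set
ConvexImage S f = ∀ x y z → S (f x) z → S z (f y) → ∃ λ w → z ≡ f w

module CoverEmbedding {n m} {R : Rel n} {S : Rel m} {f : Fin n → Fin m}
         (f-injective : Injective _≡_ _≡_ f) (f-embedding : ∀ x y → R x y ⇔ S (f x) (f y)) where

  private
    strict-to : ∀ {x y} → Strict R x y → Strict S (f x) (f y)
    strict-to (xy , x≢y) = Equivalence.to (f-embedding _ _) xy , x≢y ∘ f-injective

    strict-from : ∀ {x y} → Strict S (f x) (f y) → Strict R x y
    strict-from (xy , fx≢fy) = Equivalence.from (f-embedding _ _) xy , fx≢fy ∘ cong f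

  cover-reflect : ∀ {x y} → Cover S (f x) (f y) → Cover R x y
  cover-reflect (xy , noMiddle) =
    strict-from xy , λ (z , xz , zy) → noMiddle (f z , strict-to xz , strict-to zy)

  cover-preserve : ConvexImage S f → ∀ {x y} → Cover R x y → Cover S (f x) (f y)
  cover-preserve convex (xy , noMiddle) = strict-to xy , middle
    where
    middle : ¬ ∃ λ z → Strict S (f _) z × Strict S z (f _)
    middle (z , xz , zy) with convex _ _ z (proj₁ xz) (proj₁ zy)
    ... | w , refl = noMiddle (w , strict-from xz , strict-from zy)

open CoverEmbedding

Isomorphic⇒cover-count : ∀ {n m k} {R : Rel n} {S : Rel m} →
                         Isomorphic R S → CoverCount S k → CoverCount R k
Isomorphic⇒cover-count {R = R} {S} (f , R⇔S) count =
  Count-resp-⇔ pull-back (Count-image (both-injective from-injective) count)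
  where
  open Inverse f
  to-injective : Injective _≡_ _≡_ to
  to-injective = Injection.injective (↔⇒↣ f)
  from-injective : Injective _≡_ _≡_ from
  from-injective = Injection.injective (↔⇒↣ (↔-sym f))
  pull-back : ∀ xy → Image (both from) (uncurry (Cover S)) xy ⇔ uncurry (Cover R) xy
  pull-back (x , y) = mk⇔ reflect preserve
    where
    reflect : Image (both from) (uncurry (Cover S)) (x , y) → Cover R x y
    reflect ((a , b) , refl , ab) = cover-reflect {R = R} {S} to-injective R⇔S
      (subst₂ (Cover S) (sym (strictlyInverseˡ a)) (sym (strictlyInverseˡ b)) ab)
    preserve : Cover R x y → Image (both from) (uncurry (Cover S)) (x , y)
    preserve xy = (to x , to y) , sym (cong₂ _,_ (strictlyInverseʳ x) (strictlyInverseʳ y)) ,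
      cover-preserve {R = R} {S} to-injective R⇔S (λ _ _ z _ _ → from z , sym (strictlyInverseˡ z)) xy

Jump : ∀ {m} → Fin m → Fin m → Set
Jump i j = toℕ j ≡ 2 + toℕ i ⊎ toℕ j ≡ 3 + toℕ i

Jump-lower : ∀ {m} {i j : Fin m} → Jump i j → 2 + toℕ i ≤ toℕ j
Jump-lower (inj₁ e) = ≤-reflexive (sym e)
Jump-lower (inj₂ e) = ≤-trans (n≤1+n _) (≤-reflexive (sym e))

Jump-upper : ∀ {m} {i j : Fin m} → Jump i j → toℕ j ≤ 3 + toℕ i
Jump-upper (inj₁ e) = ≤-trans (≤-reflexive e) (n≤1+n _)
Jump-upper (inj₂ e) = ≤-reflexive e

𝒬-strict⇒gap : ∀ {m} {i j : Fin m} → Strict (𝒬 m) i j → 2 + toℕ i ≤ toℕ j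
𝒬-strict⇒gap (inj₁ i≡j , i≢j) = ⊥-elim (i≢j i≡j)
𝒬-strict⇒gap (inj₂ gap , _) = gap

gap⇒𝒬-strict : ∀ {m} {i j : Fin m} → 2 + toℕ i ≤ toℕ j → Strict (𝒬 m) i j
gap⇒𝒬-strict gap = inj₂ gap , <⇒≢ᶠ (≤-trans (n≤1+n _) gap)

jump⇒𝒬-cover : ∀ {m} {i j : Fin m} → Jump i j → Cover (𝒬 m) i j
jump⇒𝒬-cover ij = gap⇒𝒬-strict (Jump-lower ij) , λ (c , ic , cj) →
  1+n≰n (≤-trans (+-monoʳ-≤ 2 (𝒬-strict⇒gap ic)) (≤-trans (𝒬-strict⇒gap cj) (Jump-upper ij)))

𝒬-cover⇒jump : ∀ {m} {i j : Fin m} → Cover (𝒬 m) i j → Jump i j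
𝒬-cover⇒jump {m} {i} {j} (ij , noMiddle) with toℕ j ≤? 3 + toℕ i
... | yes j≤3+i = Sum.map₁ (λ j<3+i → ≤-antisym (≤-pred j<3+i) (𝒬-strict⇒gap ij)) (m≤n⇒m<n∨m≡n j≤3+i)
... | no j≰3+i = ⊥-elim (noMiddle (c , gap⇒𝒬-strict (≤-reflexive (sym c≡2+i)) , gap⇒𝒬-strict c+2≤j))
  where
  -- a jump longer than 3 leaves room for the midpoint i + 2
  4+i≤j : 4 + toℕ i ≤ toℕ j
  4+i≤j = ≰⇒> j≰3+i
  2+i<m : 2 + toℕ i < m
  2+i<m = ≤-trans (n≤1+n _) (≤-trans 4+i≤j (<⇒≤ (toℕ<n j)))
  c : Fin m
  c = fromℕ< 2+i<m
  c≡2+i : toℕ c ≡ 2 + toℕ i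
  c≡2+i = toℕ-fromℕ< 2+i<m
  c+2≤j : 2 + toℕ c ≤ toℕ j
  c+2≤j = subst (λ t → 2 + t ≤ toℕ j) (sym c≡2+i) 4+i≤j

jump⇔𝒬-cover : ∀ {m} (ij : Fin m × Fin m) → uncurry Jump ij ⇔ uncurry (Cover (𝒬 m)) ij
jump⇔𝒬-cover _ = mk⇔ jump⇒𝒬-cover 𝒬-cover⇒jump

jump-cases : ∀ {m} {a b : Fin (suc m)} → Jump a b →
             (a ≡ zero × Jump {suc m} zero b) ⊎ Image (both suc) (uncurry Jump) (a , b)
jump-cases {a = zero} ab = inj₁ (refl , ab)
jump-cases {a = suc a} {zero} (inj₁ ())
jump-cases {a = suc a} {zero} (inj₂ ())
jump-cases {a = suc a} {suc b} ab = inj₂ ((a , b) , refl , Sum.map suc-injective suc-injective ab)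

jumps-of-Fin3 : ∀ ab → ab ≡ (zero , suc (suc zero)) ⇔ uncurry (Jump {3}) ab
jumps-of-Fin3 (a , b) = mk⇔ (λ { refl → inj₁ refl }) classify
  where
  classify : Jump a b → (a , b) ≡ (zero , suc (suc zero))
  classify ab with jump-cases ab
  ... | inj₁ (refl , inj₁ b≡2) = cong (zero ,_) (toℕ-injective b≡2)
  ... | inj₁ (refl , inj₂ b≡3) = ⊥-elim (<-irrefl b≡3 (toℕ<n b))
  ... | inj₂ ((a′ , b′) , refl , a′b′) = ⊥-elim (≤⇒≯ (m+n≤o⇒m≤o 2 (Jump-lower a′b′)) (toℕ<n b′))

jumps-of-suc : ∀ {m} ab → ((ab ≡ (zero , suc (suc zero)) ⊎ ab ≡ (zero , suc (suc (suc zero))))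
                                ⊎ Image (both suc) (uncurry Jump) ab) ⇔ uncurry (Jump {4 + m}) ab
jumps-of-suc (a , b) = mk⇔ jump classify
  where
  jump : _ → Jump a b
  jump (inj₁ (inj₁ refl)) = inj₁ refl
  jump (inj₁ (inj₂ refl)) = inj₂ refl
  jump (inj₂ (_ , refl , a′b′)) = Sum.map (cong suc) (cong suc) a′b′
  classify : Jump a b → _
  classify ab with jump-cases ab
  ... | inj₁ (refl , inj₁ b≡2) = inj₁ (inj₁ (cong (zero ,_) (toℕ-injective b≡2)))
  ... | inj₁ (refl , inj₂ b≡3) = inj₁ (inj₂ (cong (zero ,_) (toℕ-injective b≡3)))
  ... | inj₂ shifted = inj₂ shifted

jump-count : ∀ k → Count (uncurry (Jump {3 + k})) (suc (k + k))
jump-count zero = Count-resp-⇔ jumps-of-Fin3 (Count-singleton _)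
jump-count (suc k) =
  subst (Count _) (cong (λ n → suc (suc n)) (sym (+-suc k k)))
    (Count-resp-⇔ jumps-of-suc
      (Count-⊎ (λ { _ (inj₁ refl) (_ , () , _) ; _ (inj₂ refl) (_ , () , _) })
        (Count-⊎ (λ { _ refl () }) (Count-singleton _) (Count-singleton _))
        (Count-image (both-injective suc-injectiveᶠ) (jump-count k))))

𝒬-cover-count : ∀ k → CoverCount (𝒬 (3 + k)) (suc (k + k))
𝒬-cover-count k = Count-resp-⇔ jump⇔𝒬-cover (jump-count k)

record MaximalTops {N : ℕ} (P : BP N) : Set where
  open BP P
  field
    reflexive : ∀ a → a ⊑ a
    tops-distinct : top₀ ≢ top₁
    top₀-maximal : ∀ {a} → top₀ ⊑ a → a ≡ top₀
    top₁-maximal : ∀ {a} → top₁ ⊑ a → a ≡ top₁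

𝒬-maximal : ∀ {m} {i j : Fin m} → m ≤ 2 + toℕ i → 𝒬 m i j → j ≡ i
𝒬-maximal _ (inj₁ i≡j) = sym i≡j
𝒬-maximal {j = j} m≤2+i (inj₂ gap) = ⊥-elim (≤⇒≯ m≤2+i (≤-<-trans gap (toℕ<n j)))

𝒬BP-maximalTops : ∀ k → MaximalTops (𝒬BP (suc k))
𝒬BP-maximalTops k = record
  { reflexive = λ _ → inj₁ refl
  ; tops-distinct = fromℕ≢inject₁
  ; top₀-maximal = 𝒬-maximal (≤-trans (n≤1+n _) (≤-reflexive (cong (2 +_) (sym (toℕ-fromℕ (suc (suc k)))))))
  ; top₁-maximal = 𝒬-maximal (≤-reflexive (cong (2 +_) (sym (trans (toℕ-inject₁ (fromℕ (suc k))) (toℕ-fromℕ (suc k))))))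
  }

module SpliceStep {p : ℕ} (P : BP p) (P-tops : MaximalTops P) (k : ℕ) where
  open Splice P (𝒬BP (suc k)) (λ ())
  open BP P using (top₀; top₁) renaming (_⊑_ to _⊑P_)
  open MaximalTops P-tops

  _⊑Q_ : Rel (3 + k)
  _⊑Q_ = 𝒬 (3 + k)

  inP-injective : Injective _≡_ _≡_ inP
  inP-injective = ↑ˡ-injective (suc k) _ _

  inP≢↑ʳ : ∀ {a j} → inP a ≢ p ↑ʳ j
  inP≢↑ʳ {a} {j} e
    with trans (sym (splitAt-↑ˡ p a (suc k))) (trans (cong (splitAt p) e) (splitAt-↑ʳ p (suc k) j))
  ... | ()

  inQ≡inP : ∀ {b a} → inQ b ≡ inP a → (b ≡ zero × a ≡ top₀) ⊎ (b ≡ suc zero × a ≡ top₁)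
  inQ≡inP {zero} e = inj₁ (refl , sym (inP-injective e))
  inQ≡inP {suc zero} e = inj₂ (refl , sym (inP-injective e))
  inQ≡inP {suc (suc j)} e = ⊥-elim (inP≢↑ʳ (sym e))

  inQ-injective : Injective _≡_ _≡_ inQ
  inQ-injective {zero} {zero} _ = refl
  inQ-injective {zero} {suc zero} e = ⊥-elim (tops-distinct (inP-injective e))
  inQ-injective {zero} {suc (suc j)} e = ⊥-elim (inP≢↑ʳ e)
  inQ-injective {suc zero} {zero} e = ⊥-elim (tops-distinct (inP-injective (sym e)))
  inQ-injective {suc zero} {suc zero} _ = refl
  inQ-injective {suc zero} {suc (suc j)} e = ⊥-elim (inP≢↑ʳ e)
  inQ-injective {suc (suc i)} {zero} e = ⊥-elim (inP≢↑ʳ (sym e))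
  inQ-injective {suc (suc i)} {suc zero} e = ⊥-elim (inP≢↑ʳ (sym e))
  inQ-injective {suc (suc i)} {suc (suc j)} e = cong (λ j → suc (suc j)) (↑ʳ-injective p i j e)

  identified-bottom : ∀ {b a} → inQ b ≡ inP a → toℕ b ≤ 1
  identified-bottom {b} e with inQ≡inP {b} e
  ... | inj₁ (refl , _) = z≤n
  ... | inj₂ (refl , _) = s≤s z≤n

  identified-maximal : ∀ {b a a′} → inQ b ≡ inP a → a ⊑P a′ → a′ ≡ a
  identified-maximal {b} e with inQ≡inP {b} e
  ... | inj₁ (_ , refl) = top₀-maximal
  ... | inj₂ (_ , refl) = top₁-maximal

  𝒬-below-bottom : ∀ {b b′} → toℕ b′ ≤ 1 → b ⊑Q b′ → b ≡ b′
  𝒬-below-bottom _ (inj₁ b≡b′) = b≡b′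
  𝒬-below-bottom b′≤1 (inj₂ gap) = ⊥-elim (≤⇒≯ b′≤1 (m+n≤o⇒m≤o 2 gap))

  elim-cross : ∀ {a b} {C : Set} → (∀ {a₀ b₀} → inQ b₀ ≡ inP a₀ → a ⊑P a₀ → b₀ ⊑Q b → C) →
               (a ⊑P top₀ × zero ⊑Q b) ⊎ (a ⊑P top₁ × suc zero ⊑Q b) → C
  elim-cross through (inj₁ (a⊑ , ⊑b)) = through refl a⊑ ⊑b
  elim-cross through (inj₂ (a⊑ , ⊑b)) = through refl a⊑ ⊑b

  below-inP : ∀ {x a′} → x ⊑S inP a′ → ∃ λ a → x ≡ inP a × a ⊑P a′
  below-inP (inj₁ (a , _ , refl , e , a⊑)) with inP-injective e
  ... | refl = a , refl , a⊑
  below-inP {a′ = a′} (inj₂ (inj₁ (b , b′ , refl , e , b⊑))) with 𝒬-below-bottom (identified-bottom e) b⊑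
  ... | refl = a′ , e , reflexive a′
  below-inP (inj₂ (inj₂ (a , b , refl , e , cross))) = a , refl , elim-cross through cross
    where
    through : ∀ {a₀ b₀} → inQ b₀ ≡ inP a₀ → a ⊑P a₀ → b₀ ⊑Q b → a ⊑P _
    through e₀ a⊑ b₀⊑ with 𝒬-below-bottom (identified-bottom e) b₀⊑
    ... | refl = subst (a ⊑P_) (inP-injective (trans (sym e₀) e)) a⊑

  above-inQ : ∀ {b y} → inQ b ⊑S y → ∃ λ b′ → y ≡ inQ b′ × b ⊑Q b′
  above-inQ {b} (inj₁ (a , a′ , e , refl , a⊑)) with identified-maximal {b} (sym e) a⊑
  ... | refl = b , e , inj₁ refl
  above-inQ {b₁} (inj₂ (inj₁ (b , b′ , e , refl , b⊑))) with inQ-injective {b} {b₁} e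
  ... | refl = b′ , refl , b⊑
  above-inQ {b} (inj₂ (inj₂ (a , b′ , e , refl , cross))) = b′ , refl , elim-cross through cross
    where
    through : ∀ {a₀ b₀} → inQ b₀ ≡ inP a₀ → a ⊑P a₀ → b₀ ⊑Q b′ → b ⊑Q b′
    through {b₀ = b₀} e₀ a⊑ b₀⊑ with identified-maximal {b} (sym e) a⊑
    ... | refl = subst (_⊑Q b′) (inQ-injective {b₀} {b} (trans e₀ e)) b₀⊑

  inP-embedding : ∀ a a′ → a ⊑P a′ ⇔ inP a ⊑S inP a′
  inP-embedding a a′ = mk⇔ (λ a⊑ → inj₁ (a , a′ , refl , refl , a⊑)) reflect
    where
    reflect : inP a ⊑S inP a′ → a ⊑P a′
    reflect a⊑ with below-inP a⊑
    ... | _ , e , a⊑′ = subst (_⊑P a′) (sym (inP-injective e)) a⊑′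

  inQ-embedding : ∀ b b′ → b ⊑Q b′ ⇔ inQ b ⊑S inQ b′
  inQ-embedding b b′ = mk⇔ (λ b⊑ → inj₂ (inj₁ (b , b′ , refl , refl , b⊑))) reflect
    where
    reflect : inQ b ⊑S inQ b′ → b ⊑Q b′
    reflect b⊑ with above-inQ b⊑
    ... | b″ , e , b⊑″ = subst (b ⊑Q_) (sym (inQ-injective {b′} {b″} e)) b⊑″

  module P↪S = CoverEmbedding {R = _⊑P_} {_⊑S_} inP-injective inP-embedding
  module Q↪S = CoverEmbedding {R = _⊑Q_} {_⊑S_} {inQ} (λ {b} {b′} → inQ-injective {b} {b′}) inQ-embedding

  FromP FromQ : Fin (p + suc k) × Fin (p + suc k) → Set
  FromP = Image (both inP) (uncurry (Cover _⊑P_))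
  FromQ = Image (both inQ) (uncurry (Cover _⊑Q_))

  from-P : ∀ {a a′} → Cover _⊑S_ (inP a) (inP a′) → FromP (inP a , inP a′)
  from-P cov = _ , refl , P↪S.cover-reflect cov

  from-Q : ∀ {b b′} → Cover _⊑S_ (inQ b) (inQ b′) → FromQ (inQ b , inQ b′)
  from-Q {b} {b′} cov = (b , b′) , refl , Q↪S.cover-reflect cov

  cross-cover : ∀ {a b a₀ b₀} → inQ b₀ ≡ inP a₀ → a ⊑P a₀ → b₀ ⊑Q b →
                Cover _⊑S_ (inP a) (inQ b) → FromP (inP a , inQ b) ⊎ FromQ (inP a , inQ b)
  cross-cover {a} {b} {a₀} {b₀} e a⊑ ⊑b cov with a Fin.≟ a₀ | inQ b Fin.≟ inP a₀
  ... | yes refl | _ =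
    inj₂ (subst (λ x → FromQ (x , inQ b)) e (from-Q {b₀} {b} (subst (λ x → Cover _⊑S_ x (inQ b)) (sym e) cov)))
  ... | no _ | yes e′ =
    inj₁ (subst (λ y → FromP (inP a , y)) (sym e′) (from-P (subst (Cover _⊑S_ (inP a)) e′ cov)))
  ... | no a≢a₀ | no b≢a₀ = ⊥-elim (proj₂ cov (inP a₀ , a≺a₀ , a₀≺b))
    where
    a≺a₀ : Strict _⊑S_ (inP a) (inP a₀)
    a≺a₀ = inj₁ (a , a₀ , refl , refl , a⊑) , a≢a₀ ∘ inP-injective
    a₀≺b : Strict _⊑S_ (inP a₀) (inQ b)
    a₀≺b = subst (_⊑S inQ b) e (inj₂ (inj₁ (b₀ , b , refl , refl , ⊑b))) , b≢a₀ ∘ sym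

  cover-split : ∀ xy → uncurry (Cover _⊑S_) xy → FromP xy ⊎ FromQ xy
  cover-split _ cov@((inj₁ (_ , _ , refl , refl , _) , _) , _) = inj₁ (from-P cov)
  cover-split _ cov@((inj₂ (inj₁ (b , b′ , refl , refl , _)) , _) , _) = inj₂ (from-Q {b} {b′} cov)
  cover-split _ cov@((inj₂ (inj₂ (_ , _ , refl , refl , cross)) , _) , _) =
    elim-cross (λ e a⊑ ⊑b → cross-cover e a⊑ ⊑b cov) cross

  splice-covers : ∀ xy → (FromP xy ⊎ FromQ xy) ⇔ uncurry (Cover _⊑S_) xy
  splice-covers xy = mk⇔ [ (λ { (_ , refl , cov) → P↪S.cover-preserve down-closed cov })
                         , (λ { (_ , refl , cov) → Q↪S.cover-preserve up-closed cov }) ]′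
                         (cover-split xy)
    where
    down-closed : ConvexImage _⊑S_ inP
    down-closed _ _ _ _ z⊑ with below-inP z⊑
    ... | a , e , _ = a , e
    up-closed : ConvexImage _⊑S_ inQ
    up-closed x _ _ ⊑z _ with above-inQ {x} ⊑z
    ... | b , e , _ = b , e

  from-P-and-Q : ∀ xy → FromP xy → FromQ xy → ⊥
  from-P-and-Q _ ((a , a′) , refl , _) ((b , b′) , e , (b⊑ , b≢b′) , _) =
    b≢b′ (𝒬-below-bottom (identified-bottom {b′} {a′} (sym (,-injectiveʳ e))) b⊑)

  splice-cover-count : ∀ {c} → CoverCount _⊑P_ c → CoverCount _⊑S_ (c + suc (k + k))
  splice-cover-count count =
    Count-resp-⇔ splice-covers
      (Count-⊎ from-P-and-Q
        (Count-image (both-injective inP-injective) count)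
        (Count-image (both-injective (λ {b} {b′} → inQ-injective {b} {b′})) (𝒬-cover-count k)))

  splice-maximalTops : MaximalTops result
  splice-maximalTops = record
    { reflexive = splice-reflexive
    ; tops-distinct = fromℕ≢inject₁ ∘ inQ-injective {fromℕ (suc (suc k))} {inject₁ (fromℕ (suc k))}
    ; top₀-maximal = λ ⊑y → top-maximal (MaximalTops.top₀-maximal (𝒬BP-maximalTops k)) ⊑y
    ; top₁-maximal = λ ⊑y → top-maximal (MaximalTops.top₁-maximal (𝒬BP-maximalTops k)) ⊑y
    }
    where
    splice-reflexive : ∀ x → x ⊑S x
    splice-reflexive x with splitAt p x | join-splitAt p (suc k) x
    ... | inj₁ a | refl = inj₁ (a , a , refl , refl , reflexive a)
    ... | inj₂ j | refl = inj₂ (inj₁ (suc (suc j) , suc (suc j) , refl , refl , inj₁ refl))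
    top-maximal : ∀ {t y} → (∀ {b} → t ⊑Q b → b ≡ t) → inQ t ⊑S y → y ≡ inQ t
    top-maximal {t} t-maximal ⊑y with above-inQ {t} ⊑y
    ... | b , refl , t⊑b = cong inQ (t-maximal t⊑b)

-- s is the number of pieces 𝒬(nᵢ); the formula 2N − s − 4 is stated without
-- truncated subtraction.
record CoverFormula {N : ℕ} (P : BP N) (s : ℕ) : Set where
  field
    tops : MaximalTops P
    covers : ℕ
    count : CoverCount (BP._⊑_ P) covers
    formula : covers + s + 4 ≡ 2 * N

𝒬BP-formula : ∀ k → CoverFormula (𝒬BP (suc k)) 1
𝒬BP-formula k = record
  { tops = 𝒬BP-maximalTops k
  ; covers = suc (k + k)
  ; count = 𝒬-cover-count k
  ; formula = arithmetic k
  }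
  where
  arithmetic : ∀ k → suc (k + k) + 1 + 4 ≡ 2 * (3 + k)
  arithmetic = solve-∀

splice-formula : ∀ {N s} {P : BP N} k → CoverFormula P s → CoverFormula (splice P (𝒬BP (suc k)) (λ ())) (suc s)
splice-formula {N} {s} {P} k F = record
  { tops = SpliceStep.splice-maximalTops P tops k
  ; covers = covers + suc (k + k)
  ; count = SpliceStep.splice-cover-count P tops k count
  ; formula = begin
      covers + suc (k + k) + suc s + 4 ≡⟨ rearrange covers k s ⟩
      covers + s + 4 + 2 * suc k      ≡⟨ cong (_+ 2 * suc k) formula ⟩
      2 * N + 2 * suc k               ≡⟨ *-distribˡ-+ 2 N (suc k) ⟨
      2 * (N + suc k)                 ∎
  }
  where
  open CoverFormula F
  open ≡-Reasoning
  rearrange : ∀ c k s → c + suc (k + k) + suc s + 4 ≡ c + s + 4 + 2 * suc k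
  rearrange = solve-∀

spliceRest-formula : ∀ {N s} (P : BP N) ms hs → CoverFormula P s →
                     CoverFormula (proj₂ (spliceRest N P ms hs)) (s + length ms)
spliceRest-formula {s = s} P [] [] F = subst (CoverFormula P) (sym (+-identityʳ s)) F
spliceRest-formula {s = s} P (_ ∷ ms) (s≤s (s≤s (s≤s {n = k} z≤n)) ∷ hs) F =
  subst (CoverFormula _) (sym (+-suc s (length ms))) (spliceRest-formula _ ms hs (splice-formula k F))

spliceRest-size : ∀ N (P : BP N) ms hs → proj₁ (spliceRest N P ms hs) + 2 * length ms ≡ N + sum ms
spliceRest-size N P [] [] = refl
spliceRest-size N P (_ ∷ ms) (s≤s (s≤s (s≤s {n = k} z≤n)) ∷ hs) =
  trans (two-more _ (length ms)) (trans (cong (2 +_) (spliceRest-size _ _ ms hs)) (regroup N k (sum ms)))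
  where
  two-more : ∀ x l → x + 2 * suc l ≡ 2 + (x + 2 * l)
  two-more = solve-∀
  regroup : ∀ N k s → 2 + (N + suc k + s) ≡ N + (3 + k + s)
  regroup = solve-∀

splice𝒬-formula : ∀ n₁ h₁ rest hs → CoverFormula (proj₂ (splice𝒬 n₁ h₁ rest hs)) (suc (length rest))
splice𝒬-formula _ (s≤s (s≤s (s≤s {n = k} z≤n))) rest hs = spliceRest-formula _ rest hs (𝒬BP-formula k)

splice𝒬-size : ∀ n₁ h₁ rest hs → proj₁ (splice𝒬 n₁ h₁ rest hs) + 2 * length rest ≡ n₁ + sum rest
splice𝒬-size _ (s≤s (s≤s (s≤s z≤n))) rest hs = spliceRest-size _ _ rest hs

m+2[1+n]∸2≡m+2n : ∀ m n → m + 2 * suc n ∸ 2 ≡ m + 2 * n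
m+2[1+n]∸2≡m+2n m n = trans (cong (_∸ 2) (shift m n)) (m+n∸n≡m (m + 2 * n) 2)
  where
  shift : ∀ m n → m + 2 * suc n ≡ m + 2 * n + 2
  shift = solve-∀

m+n+o≡p⇒p∸n∸o≡m : ∀ m n o {p} → m + n + o ≡ p → p ∸ n ∸ o ≡ m
m+n+o≡p⇒p∸n∸o≡m m n o refl = begin
  m + n + o ∸ n ∸ o       ≡⟨ ∸-+-assoc (m + n + o) n o ⟩
  m + n + o ∸ (n + o)     ≡⟨ cong (_∸ (n + o)) (+-assoc m n o) ⟩
  m + (n + o) ∸ (n + o)   ≡⟨ m+n∸n≡m m (n + o) ⟩
  m                       ∎
  where open ≡-Reasoning

-- The count depends only on the isomorphism type of the poset.
proposition8p1 : (n : ℕ) (_≼_ : Fin n → Fin n → Set) →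
    IsPartialOrder _≡_ _≼_ → IsTwoChain _≼_ →
    (n₁ : ℕ) (h₁ : 3 ≤ n₁) (rest : List ℕ) (hs : All (3 ≤_) rest) →
    n₁ + sum rest ≡ n + 2 * suc (length rest) ∸ 2 →
    Isomorphic _≼_ (BP._⊑_ (proj₂ (splice𝒬 n₁ h₁ rest hs))) →
    NumCovers _≼_ (2 * n ∸ suc (length rest) ∸ 4)
proposition8p1 n _≼_ _ _ n₁ h₁ rest hs size iso =
  subst (NumCovers _≼_) covers≡ (CoverCount⇒NumCovers (Isomorphic⇒cover-count iso count))
  where
  open CoverFormula (splice𝒬-formula n₁ h₁ rest hs)
  N≡n : proj₁ (splice𝒬 n₁ h₁ rest hs) ≡ n
  N≡n = +-cancelʳ-≡ (2 * length rest) _ n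
          (trans (splice𝒬-size n₁ h₁ rest hs) (trans size (m+2[1+n]∸2≡m+2n n (length rest))))
  covers≡ : covers ≡ 2 * n ∸ suc (length rest) ∸ 4
  covers≡ = sym (subst (λ N → 2 * N ∸ suc (length rest) ∸ 4 ≡ covers) N≡n
                       (m+n+o≡p⇒p∸n∸o≡m covers (suc (length rest)) 4 formula))
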